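{- Let $\alpha,\delta$ be scalar umbrae and $\gamma,\zeta$ scalar umbrae provided with compositional inverses. If $\eta_x$ is a polynomial umbra such that $$(-1.\alpha+x.u).\gamma^{*}\equiv\eta_{(-1.\delta+x.u).\zeta^{*}},$$ then $\eta_x$ is a Sheffer umbra for $\big((\alpha+(-1.\delta)).\zeta^{*},\ \gamma.\beta.\zeta^{<-1>}\big)$. (Equivalently: if $s_n(x)$ are the moments of the Sheffer umbra for $(\alpha,\gamma)$, $r_n(x)$ those of the Sheffer umbra for $(\delta,\zeta)$, and $s_n(x)=\sum_k c_{n,k}r_k(x)$, then the polynomials $\sum_kc_{n,k}x^k$ are the moments of that Sheffer umbra.)
   Context: Setting (classical umbral calculus). $R$ is a commutative integral domain whose quotient field has characteristic $0$. Umbrae are symbols with a linear evaluation $E$, $E[1]=1$, multiplicative on products of powers of pairwise distinct umbrae. Moments $a_n=E[\alpha^n]$, g.f. $f(\alpha,t)=\sum a_nt^n/n!$; similarity $\equiv$ means equal moments. Saturation: umbral expressions denote auxiliary umbrae determined up to similarity by their g.f.; distinct ones in a sum are uncorrelated. Special umbrae: unity $u$ ($e^t$), Bell $\beta$ ($\exp(e^t-1)$). G.f. rules: $f(\alpha+\gamma,t)=f(\alpha,t)f(\gamma,t)$; for a scalar $c$ (integer or indeterminate) $f(c.\alpha,t)=f(\alpha,t)^c$ (so $x.u$ has moments $x^n$, $-1.\alpha$ has g.f. $1/f(\alpha,t)$); $f(\gamma.\alpha,t)=f(\gamma,\log f(\alpha,t))$; dot-products associate, so $\gamma.\beta.\alpha$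 has g.f. $f(\gamma,f(\alpha,t)-1)$. $\gamma$ is provided with a compositional inverse if $E[\gamma]\ne0$ and $f(\gamma,t)-1$ has a compositional inverse series $h_\gamma$; then $\gamma^{<-1>}$ has g.f. $1+h_\gamma$ and the adjoint $\gamma^*=\beta.\gamma^{<-1>}$ has g.f. $\exp(h_\gamma)$. Scalar umbra: moments in $R$. A polynomial umbra $\eta_x$ has moments $q_n(x)=\sum_kq_{n,k}x^k\in R[x]$, $q_0=1$, $\deg q_n=n$; for an umbra $\sigma$ (possibly polynomial), $\eta_\sigma$ has moments $E[q_n(\sigma)]=\sum_kq_{n,k}E[\sigma^k]$. For scalar $\alpha$ and scalar $\gamma$ provided with a compositional inverse, a Sheffer umbra for $(\alpha,\gamma)$ is a polynomial umbra $\sigma_x\equiv(-1.\alpha+x.u).\gamma^*$ (g.f. $e^{xh_\gamma(t)}/f(\alpha,h_\gamma(t))$). -}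

module Defs where

open import Level using (Level; _⊔_) renaming (suc to lsuc)
open import Algebra.Bundles using (CommutativeRing)
open import Data.Nat using (ℕ; zero; suc; _∸_; _<_)
open import Data.Nat.Combinatorics using (_C_)
open import Data.Nat.Base using (_!)
open import Data.Product using (_×_)
open import Data.Sum using (_⊎_)
open import Relation.Nullary using (¬_)
open import Relation.Binary.PropositionalEquality using (_≡_)

module Scalars {c ℓ : Level} (R : CommutativeRing c ℓ) where
  open CommutativeRing R

  ntimes : ℕ → Carrier → Carrier
  ntimes zero    x = 0#
  ntimes (suc n) x = x + ntimes n x

-- The coefficient ring R: a commutative integral domain whose quotient
-- field has characteristic 0 (equivalently n·1 ≠ 0 in R for n ≥ 1).

record IntegralDomain (c ℓ : Level) : Set (lsuc (c ⊔ ℓ)) where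
  field
    commRing : CommutativeRing c ℓ
  open CommutativeRing commRing
  open Scalars commRing
  field
    nontrivial   : ¬ (1# ≈ 0#)
    noZeroDivs   : ∀ x y → x * y ≈ 0# → (x ≈ 0#) ⊎ (y ≈ 0#)
    charZero     : ∀ n → ¬ (ntimes (suc n) 1# ≈ 0#)

-- A (scalar) umbra is represented by its moment sequence a : ℕ → R,
-- a n = E[α^n]; its generating function is f(α,t) = Σ a n t^n / n!.
-- All operations below are the g.f. rules of the paper, written on
-- exponential-generating-function coefficients (no division needed).
--
-- A polynomial umbra is represented by the coefficients of its moments:
-- p n k = coefficient of x^k in the n-th moment q_n(x) ∈ R[x].

module Umbral {c ℓ : Level} (R : CommutativeRing c ℓ) where
  open CommutativeRing R
  open Scalars R public

  Seq : Set c
  Seq = ℕ → Carrier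

  PSeq : Set c
  PSeq = ℕ → ℕ → Carrier

  _≋_ : Seq → Seq → Set ℓ
  a ≋ b = ∀ n → a n ≈ b n

  _≋₂_ : PSeq → PSeq → Set ℓ
  p ≋₂ q = ∀ n k → p n k ≈ q n k

  sumUpTo : ℕ → (ℕ → Carrier) → Carrier
  sumUpTo zero    f = f 0
  sumUpTo (suc n) f = sumUpTo n f + f (suc n)

  sign : ℕ → Carrier
  sign zero    = 1#
  sign (suc k) = - sign k

  -- e.g.f. of t^k / k!
  tpow : ℕ → Seq
  tpow zero    zero    = 1#
  tpow zero    (suc n) = 0#
  tpow (suc k) zero    = 0#
  tpow (suc k) (suc n) = tpow k n

  minusOne : Seq → Seq
  minusOne a zero    = 0#
  minusOne a (suc n) = a (suc n)

  _⊛_ : Seq → Seq → Seq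
  (a ⊛ b) n = sumUpTo n (λ k → ntimes (n C k) (a k * b (n ∸ k)))

  -- partial Bell polynomials: bell g k = e.g.f. coefficients of g(t)^k / k!
  -- (the constant term of g is ignored, i.e. g is taken with g(0) = 0);
  -- defined through (g^{k+1}/(k+1)!)' = g' · g^k/k!.
  bell : Seq → ℕ → Seq
  bell g zero    n       = tpow 0 n
  bell g (suc k) zero    = 0#
  bell g (suc k) (suc n) =
    sumUpTo n (λ i → ntimes (n C i) (g (suc i) * bell g k (n ∸ i)))

  compose : Seq → Seq → Seq
  compose f g n = sumUpTo n (λ k → f k * bell g k n)

  -- e.g.f. coefficients of e^t, log(1+t), 1/(1+t)
  expSeq : Seq
  expSeq n = 1#

  logSeq : Seq
  logSeq zero    = 0#
  logSeq (suc k) = sign k * ntimes (k !) 1#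

  recipSeq : Seq
  recipSeq k = sign k * ntimes (k !) 1#

  logU : Seq → Seq
  logU a = compose logSeq (minusOne a)

  unity : Seq
  unity = expSeq

  bellU : Seq
  bellU = compose expSeq (minusOne expSeq)

  _⊕_ : Seq → Seq → Seq
  a ⊕ b = a ⊛ b

  -- -1.α : 1 / f(α,t)
  negU : Seq → Seq
  negU a = compose recipSeq (minusOne a)

  -- γ.α : f(γ, log f(α,t))
  dot : Seq → Seq → Seq
  dot γ a = compose γ (logU a)

  -- γ^{<-1>} : 1 + h_γ, given the compositional inverse series h_γ
  invU : Seq → Seq
  invU h zero    = 1#
  invU h (suc n) = h (suc n)

  adjoint : Seq → Seq
  adjoint h = dot bellU (invU h)

  IsScalar : Seq → Set ℓ
  IsScalar a = a 0 ≈ 1#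

  HasCompInv : Seq → Seq → Set ℓ
  HasCompInv γ h =
    (¬ (γ 1 ≈ 0#)) × (h 0 ≈ 0#)
      × (compose (minusOne γ) h ≋ tpow 1)
      × (compose h (minusOne γ) ≋ tpow 1)

  IsPolyUmbra : PSeq → Set ℓ
  IsPolyUmbra q =
    (q 0 0 ≈ 1#) × (∀ n k → n < k → q n k ≈ 0#)
      × (∀ n → ¬ (q n n ≈ 0#))

  xu : PSeq
  xu n k = tpow k n

  _⊕ₚ_ : Seq → PSeq → PSeq
  (a ⊕ₚ p) n k = (a ⊛ (λ m → p m k)) n

  dotₚ : PSeq → Seq → PSeq
  dotₚ p γ n k = compose (λ m → p m k) (logU γ) n

  -- η_σ : moments E[q_n(σ)] = Σ_k q_{n,k} E[σ^k]
  umbralSubst : PSeq → PSeq → PSeq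
  umbralSubst q r n j = sumUpTo n (λ k → q n k * r k j)

  -- Sheffer umbra for (α, γ), where h = h_γ:  (-1.α + x.u).γ*
  sheffer : Seq → Seq → PSeq
  sheffer a h = dotₚ (negU a ⊕ₚ xu) (adjoint h)

-- On exponential generating functions the Sheffer umbra for (α, γ) is the matrix
-- s n k = [tⁿ] B(t) h(t)ᵏ/k! with h = h_γ and B = 1/f(α, h_γ). Substituting one such matrix into
-- another composes the series: Σₖ [B gᵏ/k!]ₙ [N hʲ/j!]ₖ = [B · N(g) · h(g)ʲ/j!]ₙ. Taking
-- g = h_Γ = f(ζ, h_γ) − 1, the compositional inverse of f(Γ, t) − 1 = f(γ, h_ζ) − 1, gives
-- h_ζ ∘ h_Γ = h_γ and turns the coefficient series into 1/f(α, h_γ); hence the Sheffer umbra for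
-- ((α + −1.δ).ζ*, Γ) substituted into the one for (δ, ζ) is the one for (α, γ). The Sheffer matrix of
-- (δ, ζ) is lower triangular with diagonal entries h_ζ′(0)ʲ ≠ 0, so over an integral domain it can be
-- cancelled, which forces η to be the Sheffer umbra for ((α + −1.δ).ζ*, Γ).

module Submission where

open import Level using (Level)
open import Algebra.Bundles using (CommutativeRing)
open import Data.Nat as ℕ using (ℕ; zero; suc; _∸_; _≤_; _<_; z≤n; s≤s)
import Data.Nat.Properties as ℕ
open import Data.Nat.Combinatorics using (_C_; nCk+nC[k+1]≡[n+1]C[k+1]; k>n⇒nCk≡0)
open import Data.Nat.Base using (_!)
open import Data.Product using (Σ; _×_; _,_)
open import Data.Sum using (inj₁; inj₂)
open import Data.Empty using (⊥-elim)
open import Relation.Nullary using (¬_)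
open import Relation.Binary.Bundles using (Setoid)
open import Relation.Binary.Definitions using (tri<; tri≈; tri>)
open import Relation.Binary.PropositionalEquality as ≡ using (_≡_; _≢_)
import Relation.Binary.Reasoning.Setoid as SetoidReasoning
open import Defs

module Sums {c ℓ : Level} (R : CommutativeRing c ℓ) where
  open CommutativeRing R hiding (zero)
  open Umbral R
  open import Algebra.Properties.Semiring.Mult semiring
    using (×-congʳ; ×-homo-+; ×-assocˡ; ×-comm-*; ×-assoc-*) renaming (_×_ to _×ₙ_)
  open import Algebra.Properties.CommutativeMonoid.Mult +-commutativeMonoid
    using (×-distrib-+)
  open import Algebra.Properties.Ring ring using (-‿+-comm)
  open import Algebra.Properties.CommutativeSemigroup +-commutativeSemigroup
    using () renaming (interchange to +-interchange)

  ntimes≡× : ∀ n x → ntimes n x ≡ n ×ₙ x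
  ntimes≡× zero    x = ≡.refl
  ntimes≡× (suc n) x = ≡.cong (x +_) (ntimes≡× n x)

  ntimes-cong : ∀ n {x y} → x ≈ y → ntimes n x ≈ ntimes n y
  ntimes-cong n {x} {y} rewrite ntimes≡× n x | ntimes≡× n y = ×-congʳ n

  ntimes-congˡ : ∀ {m n} x → m ≡ n → ntimes m x ≈ ntimes n x
  ntimes-congˡ x ≡.refl = refl

  ntimes-homo-+ : ∀ m n x → ntimes (m ℕ.+ n) x ≈ ntimes m x + ntimes n x
  ntimes-homo-+ m n x rewrite ntimes≡× (m ℕ.+ n) x | ntimes≡× m x | ntimes≡× n x =
    ×-homo-+ x m n

  ntimes-assoc : ∀ m n x → ntimes (m ℕ.* n) x ≈ ntimes m (ntimes n x)
  ntimes-assoc m n x rewrite ntimes≡× (m ℕ.* n) x | ntimes≡× n x | ntimes≡× m (n ×ₙ x) =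
    sym (×-assocˡ x m n)

  ntimes-distrib-+ : ∀ n x y → ntimes n (x + y) ≈ ntimes n x + ntimes n y
  ntimes-distrib-+ n x y rewrite ntimes≡× n (x + y) | ntimes≡× n x | ntimes≡× n y =
    ×-distrib-+ x y n

  *-ntimes : ∀ n x y → x * ntimes n y ≈ ntimes n (x * y)
  *-ntimes n x y rewrite ntimes≡× n y | ntimes≡× n (x * y) = ×-comm-* n x y

  ntimes-* : ∀ n x y → ntimes n x * y ≈ ntimes n (x * y)
  ntimes-* n x y rewrite ntimes≡× n x | ntimes≡× n (x * y) = ×-assoc-* n x y

  ntimes-zero : ∀ n → ntimes n 0# ≈ 0#
  ntimes-zero zero    = refl
  ntimes-zero (suc n) = trans (+-identityˡ _) (ntimes-zero n)

  ntimes-zeroʳ : ∀ n x → ntimes n (x * 0#) ≈ 0#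
  ntimes-zeroʳ n x = trans (ntimes-cong n (zeroʳ x)) (ntimes-zero n)

  sumUpTo-cong : ∀ n {f g : ℕ → Carrier} → (∀ k → k ≤ n → f k ≈ g k) → sumUpTo n f ≈ sumUpTo n g
  sumUpTo-cong zero    f≈g = f≈g 0 z≤n
  sumUpTo-cong (suc n) f≈g =
    +-cong (sumUpTo-cong n (λ k k≤n → f≈g k (ℕ.m≤n⇒m≤1+n k≤n))) (f≈g (suc n) ℕ.≤-refl)

  sumUpTo-zero : ∀ n {f : ℕ → Carrier} → (∀ k → k ≤ n → f k ≈ 0#) → sumUpTo n f ≈ 0#
  sumUpTo-zero zero    f≈0 = f≈0 0 z≤n
  sumUpTo-zero (suc n) f≈0 =
    trans (+-cong (sumUpTo-zero n (λ k k≤n → f≈0 k (ℕ.m≤n⇒m≤1+n k≤n))) (f≈0 (suc n) ℕ.≤-refl))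
          (+-identityˡ 0#)

  sumUpTo-+ : ∀ n (f g : ℕ → Carrier) → sumUpTo n (λ k → f k + g k) ≈ sumUpTo n f + sumUpTo n g
  sumUpTo-+ zero    f g = refl
  sumUpTo-+ (suc n) f g = trans (+-congʳ (sumUpTo-+ n f g)) (+-interchange _ _ _ _)

  sumUpTo-neg : ∀ n (f : ℕ → Carrier) → sumUpTo n (λ k → - f k) ≈ - sumUpTo n f
  sumUpTo-neg zero    f = refl
  sumUpTo-neg (suc n) f = trans (+-congʳ (sumUpTo-neg n f)) (-‿+-comm _ _)

  *-distribˡ-sumUpTo : ∀ n x (f : ℕ → Carrier) → x * sumUpTo n f ≈ sumUpTo n (λ k → x * f k)
  *-distribˡ-sumUpTo zero    x f = refl
  *-distribˡ-sumUpTo (suc n) x f = trans (distribˡ x _ _) (+-congʳ (*-distribˡ-sumUpTo n x f))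

  *-distribʳ-sumUpTo : ∀ n x (f : ℕ → Carrier) → sumUpTo n f * x ≈ sumUpTo n (λ k → f k * x)
  *-distribʳ-sumUpTo zero    x f = refl
  *-distribʳ-sumUpTo (suc n) x f = trans (distribʳ x _ _) (+-congʳ (*-distribʳ-sumUpTo n x f))

  ntimes-distrib-sumUpTo : ∀ n m (f : ℕ → Carrier) →
    ntimes m (sumUpTo n f) ≈ sumUpTo n (λ k → ntimes m (f k))
  ntimes-distrib-sumUpTo zero    m f = refl
  ntimes-distrib-sumUpTo (suc n) m f =
    trans (ntimes-distrib-+ m _ _) (+-congʳ (ntimes-distrib-sumUpTo n m f))

  sumUpTo-unfoldˡ : ∀ n (f : ℕ → Carrier) → sumUpTo (suc n) f ≈ f 0 + sumUpTo n (λ k → f (suc k))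
  sumUpTo-unfoldˡ zero    f = refl
  sumUpTo-unfoldˡ (suc n) f = trans (+-congʳ (sumUpTo-unfoldˡ n f)) (+-assoc _ _ _)

  sumUpTo-swap : ∀ n m (F : ℕ → ℕ → Carrier) →
    sumUpTo n (λ i → sumUpTo m (F i)) ≈ sumUpTo m (λ j → sumUpTo n (λ i → F i j))
  sumUpTo-swap zero    m F = refl
  sumUpTo-swap (suc n) m F =
    trans (+-congʳ (sumUpTo-swap n m F)) (sym (sumUpTo-+ m (λ j → sumUpTo n (λ i → F i j)) (F (suc n))))

  sumUpTo-truncate : ∀ m n (f : ℕ → Carrier) → m ≤ n → (∀ k → m < k → k ≤ n → f k ≈ 0#) →
    sumUpTo n f ≈ sumUpTo m f
  sumUpTo-truncate m zero    f z≤n   tail≈0 = refl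
  sumUpTo-truncate m (suc n) f m≤1+n tail≈0 with ℕ.m≤n⇒m<n∨m≡n m≤1+n
  ... | inj₂ ≡.refl      = refl
  ... | inj₁ (s≤s m≤n) =
    trans (+-cong (sumUpTo-truncate m n f m≤n (λ k m<k k≤n → tail≈0 k m<k (ℕ.m≤n⇒m≤1+n k≤n)))
                  (tail≈0 (suc n) (s≤s m≤n) ℕ.≤-refl))
          (+-identityʳ _)

  sumUpTo-single : ∀ n j (f : ℕ → Carrier) → j ≤ n → (∀ k → k ≤ n → k ≢ j → f k ≈ 0#) →
    sumUpTo n f ≈ f j
  sumUpTo-single zero    .zero f z≤n   others≈0 = refl
  sumUpTo-single (suc n) j     f j≤1+n others≈0 with ℕ.m≤n⇒m<n∨m≡n j≤1+n
  ... | inj₂ ≡.refl =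
    trans (+-congʳ (sumUpTo-zero n (λ k k≤n → others≈0 k (ℕ.m≤n⇒m≤1+n k≤n) (ℕ.<⇒≢ (s≤s k≤n)))))
          (+-identityˡ _)
  ... | inj₁ (s≤s j≤n) =
    trans (+-cong (sumUpTo-single n j f j≤n (λ k k≤n → others≈0 k (ℕ.m≤n⇒m≤1+n k≤n)))
                  (others≈0 (suc n) ℕ.≤-refl (ℕ.>⇒≢ (s≤s j≤n))))
          (+-identityʳ _)

module Series {c ℓ : Level} (R : CommutativeRing c ℓ) where
  open CommutativeRing R hiding (zero)
  open Umbral R
  open Sums R
  open import Algebra.Properties.Ring ring using (-‿distribˡ-*)
  module ≈-Reasoning = SetoidReasoning setoid

  ≋-setoid : Setoid c ℓ
  ≋-setoid = record
    { Carrier       = Seq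
    ; _≈_           = _≋_
    ; isEquivalence = record
      { refl  = λ _ → refl
      ; sym   = λ a≋b n → sym (a≋b n)
      ; trans = λ a≋b b≋d n → trans (a≋b n) (b≋d n)
      }
    }

  open Setoid ≋-setoid public using () renaming (refl to ≋-refl; sym to ≋-sym; trans to ≋-trans)
  module ≋-Reasoning = SetoidReasoning ≋-setoid

  ∂ : Seq → Seq
  ∂ a n = a (suc n)

  _+ₛ_ : Seq → Seq → Seq
  (a +ₛ b) n = a n + b n

  0ₛ : Seq
  0ₛ n = 0#

  _≋[≤_]_ : Seq → ℕ → Seq → Set ℓ
  a ≋[≤ n ] b = ∀ m → m ≤ n → a m ≈ b m

  -- Equality up to the constant term, which composition on the right ignores.
  _≋⁺_ : Seq → Seq → Set ℓ
  a ≋⁺ b = ∀ m → a (suc m) ≈ b (suc m)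

  ≋⇒≋[≤] : ∀ {a b} → a ≋ b → ∀ n → a ≋[≤ n ] b
  ≋⇒≋[≤] a≋b n m _ = a≋b m

  ≋⇒≋⁺ : ∀ {a b} → a ≋ b → a ≋⁺ b
  ≋⇒≋⁺ a≋b m = a≋b (suc m)

  ≋[≤0] : ∀ {a b} → a 0 ≈ b 0 → a ≋[≤ 0 ] b
  ≋[≤0] a₀≈b₀ .zero z≤n = a₀≈b₀

  ≋[≤suc] : ∀ {a b} n → a ≋[≤ n ] b → a (suc n) ≈ b (suc n) → a ≋[≤ suc n ] b
  ≋[≤suc] n a≋b aₙ₊₁≈bₙ₊₁ m m≤1+n with ℕ.m≤n⇒m<n∨m≡n m≤1+n
  ... | inj₂ ≡.refl      = aₙ₊₁≈bₙ₊₁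
  ... | inj₁ (s≤s m≤n) = a≋b m m≤n

  ≋[≤]⇒≋ : ∀ {a b} → (∀ n → a ≋[≤ n ] b) → a ≋ b
  ≋[≤]⇒≋ a≋b n = a≋b n n ℕ.≤-refl

  ⊛-constant : ∀ a b → (a ⊛ b) 0 ≈ a 0 * b 0
  ⊛-constant a b = +-identityʳ _

  ⊛-cong≤ : ∀ n {a a′ b b′} → a ≋[≤ n ] a′ → b ≋[≤ n ] b′ → (a ⊛ b) n ≈ (a′ ⊛ b′) n
  ⊛-cong≤ n a≋a′ b≋b′ = sumUpTo-cong n (λ k k≤n →
    ntimes-cong (n C k) (*-cong (a≋a′ k k≤n) (b≋b′ (n ∸ k) (ℕ.m∸n≤m n k))))

  ⊛-cong : ∀ {a a′ b b′} → a ≋ a′ → b ≋ b′ → (a ⊛ b) ≋ (a′ ⊛ b′)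
  ⊛-cong a≋a′ b≋b′ n = ⊛-cong≤ n (≋⇒≋[≤] a≋a′ n) (≋⇒≋[≤] b≋b′ n)

  ⊛-congˡ : ∀ a {b b′} → b ≋ b′ → (a ⊛ b) ≋ (a ⊛ b′)
  ⊛-congˡ a = ⊛-cong {a} {a} ≋-refl

  ⊛-congʳ : ∀ b {a a′} → a ≋ a′ → (a ⊛ b) ≋ (a′ ⊛ b)
  ⊛-congʳ b a≋a′ = ⊛-cong {b = b} {b} a≋a′ ≋-refl

  ⊛-distribʳ : ∀ a a′ b → ((a +ₛ a′) ⊛ b) ≋ ((a ⊛ b) +ₛ (a′ ⊛ b))
  ⊛-distribʳ a a′ b n = trans
    (sumUpTo-cong n (λ k _ →
      trans (ntimes-cong (n C k) (distribʳ _ _ _)) (ntimes-distrib-+ (n C k) _ _)))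
    (sumUpTo-+ n _ _)

  ⊛-distribˡ : ∀ a b b′ → (a ⊛ (b +ₛ b′)) ≋ ((a ⊛ b) +ₛ (a ⊛ b′))
  ⊛-distribˡ a b b′ n = trans
    (sumUpTo-cong n (λ k _ →
      trans (ntimes-cong (n C k) (distribˡ _ _ _)) (ntimes-distrib-+ (n C k) _ _)))
    (sumUpTo-+ n _ _)

  ⊛-zeroˡ : ∀ b → (0ₛ ⊛ b) ≋ 0ₛ
  ⊛-zeroˡ b n = sumUpTo-zero n (λ k _ → trans (ntimes-cong (n C k) (zeroˡ _)) (ntimes-zero (n C k)))

  -- Pascal's rule for the binomial coefficients of the convolution.
  ⊛-leibniz : ∀ a b n → (a ⊛ b) (suc n) ≈ (∂ a ⊛ b) n + (a ⊛ ∂ b) n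
  ⊛-leibniz a b n = begin
      (a ⊛ b) (suc n)
    ≈⟨ sumUpTo-unfoldˡ n T ⟩
      T 0 + sumUpTo n (λ k → T (suc k))
    ≈⟨ +-congˡ (trans (sumUpTo-cong n (λ k _ → pascal k)) (sumUpTo-+ n _ _)) ⟩
      T 0 + ((∂ a ⊛ b) n + Y)
    ≈⟨ trans (+-congˡ (+-comm _ _)) (trans (sym (+-assoc _ _ _)) (+-comm _ _)) ⟩
      (∂ a ⊛ b) n + (U 0 + Y)
    ≈⟨ +-congˡ (sym (sumUpTo-unfoldˡ n U)) ⟩
      (∂ a ⊛ b) n + (sumUpTo n U + U (suc n))
    ≈⟨ +-congˡ (trans (+-congˡ Uₙ₊₁≈0) (+-identityʳ _)) ⟩
      (∂ a ⊛ b) n + sumUpTo n U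
    ≈⟨ +-congˡ (sumUpTo-cong n (λ k k≤n →
         ntimes-cong (n C k) (*-congˡ (reflexive (≡.cong b (ℕ.+-∸-assoc 1 k≤n)))))) ⟩
      (∂ a ⊛ b) n + (a ⊛ ∂ b) n ∎
    where
      open ≈-Reasoning
      T U : ℕ → Carrier
      T k = ntimes (suc n C k) (a k * b (suc n ∸ k))
      U k = ntimes (n C k) (a k * b (suc n ∸ k))
      Y : Carrier
      Y = sumUpTo n (λ k → ntimes (n C suc k) (a (suc k) * b (n ∸ k)))
      pascal : ∀ k → T (suc k) ≈ ntimes (n C k) (a (suc k) * b (n ∸ k))
                                  + ntimes (n C suc k) (a (suc k) * b (n ∸ k))
      pascal k = trans (ntimes-congˡ _ (≡.sym (nCk+nC[k+1]≡[n+1]C[k+1] n k)))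
                       (ntimes-homo-+ (n C k) (n C suc k) _)
      Uₙ₊₁≈0 : U (suc n) ≈ 0#
      Uₙ₊₁≈0 = ntimes-congˡ _ (k>n⇒nCk≡0 (ℕ.n<1+n n))

  ⊛-comm : ∀ a b → (a ⊛ b) ≋ (b ⊛ a)
  ⊛-comm a b zero    = trans (⊛-constant a b) (trans (*-comm _ _) (sym (⊛-constant b a)))
  ⊛-comm a b (suc n) = begin
    (a ⊛ b) (suc n)           ≈⟨ ⊛-leibniz a b n ⟩
    (∂ a ⊛ b) n + (a ⊛ ∂ b) n ≈⟨ +-cong (⊛-comm (∂ a) b n) (⊛-comm a (∂ b) n) ⟩
    (b ⊛ ∂ a) n + (∂ b ⊛ a) n ≈⟨ +-comm _ _ ⟩
    (∂ b ⊛ a) n + (b ⊛ ∂ a) n ≈⟨ ⊛-leibniz b a n ⟨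
    (b ⊛ a) (suc n)           ∎
    where open ≈-Reasoning

  ⊛-assoc : ∀ a b d → ((a ⊛ b) ⊛ d) ≋ (a ⊛ (b ⊛ d))
  ⊛-assoc a b d zero = begin
    ((a ⊛ b) ⊛ d) 0     ≈⟨ trans (⊛-constant (a ⊛ b) d) (*-congʳ (⊛-constant a b)) ⟩
    (a 0 * b 0) * d 0   ≈⟨ *-assoc _ _ _ ⟩
    a 0 * (b 0 * d 0)   ≈⟨ trans (⊛-constant a (b ⊛ d)) (*-congˡ (⊛-constant b d)) ⟨
    (a ⊛ (b ⊛ d)) 0     ∎
    where open ≈-Reasoning
  ⊛-assoc a b d (suc n) = begin
    ((a ⊛ b) ⊛ d) (suc n)
      ≈⟨ ⊛-leibniz (a ⊛ b) d n ⟩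
    (∂ (a ⊛ b) ⊛ d) n + ((a ⊛ b) ⊛ ∂ d) n
      ≈⟨ +-congʳ (trans (⊛-congʳ d (⊛-leibniz a b) n) (⊛-distribʳ (∂ a ⊛ b) (a ⊛ ∂ b) d n)) ⟩
    (((∂ a ⊛ b) ⊛ d) n + ((a ⊛ ∂ b) ⊛ d) n) + ((a ⊛ b) ⊛ ∂ d) n
      ≈⟨ +-cong (+-cong (⊛-assoc (∂ a) b d n) (⊛-assoc a (∂ b) d n)) (⊛-assoc a b (∂ d) n) ⟩
    ((∂ a ⊛ (b ⊛ d)) n + (a ⊛ (∂ b ⊛ d)) n) + (a ⊛ (b ⊛ ∂ d)) n
      ≈⟨ +-assoc _ _ _ ⟩
    (∂ a ⊛ (b ⊛ d)) n + ((a ⊛ (∂ b ⊛ d)) n + (a ⊛ (b ⊛ ∂ d)) n)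
      ≈⟨ +-congˡ (trans (⊛-congˡ a (⊛-leibniz b d) n) (⊛-distribˡ a (∂ b ⊛ d) (b ⊛ ∂ d) n)) ⟨
    (∂ a ⊛ (b ⊛ d)) n + (a ⊛ ∂ (b ⊛ d)) n
      ≈⟨ ⊛-leibniz a (b ⊛ d) n ⟨
    (a ⊛ (b ⊛ d)) (suc n) ∎
    where open ≈-Reasoning

  ⊛-identityˡ : ∀ a → (tpow 0 ⊛ a) ≋ a
  ⊛-identityˡ a zero    = trans (⊛-constant (tpow 0) a) (*-identityˡ _)
  ⊛-identityˡ a (suc n) = begin
    (tpow 0 ⊛ a) (suc n)                    ≈⟨ ⊛-leibniz (tpow 0) a n ⟩
    (∂ (tpow 0) ⊛ a) n + (tpow 0 ⊛ ∂ a) n   ≈⟨ +-cong (⊛-zeroˡ a n) (⊛-identityˡ (∂ a) n) ⟩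
    0# + a (suc n)                          ≈⟨ +-identityˡ _ ⟩
    a (suc n)                               ∎
    where open ≈-Reasoning

  ⊛-identityʳ : ∀ a → (a ⊛ tpow 0) ≋ a
  ⊛-identityʳ a = ≋-trans (⊛-comm a (tpow 0)) (⊛-identityˡ a)

  ⊛-vanishʳ : ∀ B b n → (∀ m → m ≤ n → b m ≈ 0#) → (B ⊛ b) n ≈ 0#
  ⊛-vanishʳ B b n b≈0 = sumUpTo-zero n (λ i _ →
    trans (ntimes-cong (n C i) (*-congˡ (b≈0 (n ∸ i) (ℕ.m∸n≤m n i)))) (ntimes-zeroʳ (n C i) _))

  bell-vanish : ∀ g k n → n < k → bell g k n ≈ 0#
  bell-vanish g (suc k) zero    _         = refl
  bell-vanish g (suc k) (suc n) (s≤s n<k) =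
    ⊛-vanishʳ (∂ g) (bell g k) n (λ m m≤n → bell-vanish g k m (ℕ.≤-<-trans m≤n n<k))

  bell-cong : ∀ {g g′} → g ≋⁺ g′ → ∀ k n → bell g k n ≈ bell g′ k n
  bell-cong g≋g′ zero    n       = refl
  bell-cong g≋g′ (suc k) zero    = refl
  bell-cong g≋g′ (suc k) (suc n) =
    sumUpTo-cong n (λ i _ → ntimes-cong (n C i) (*-cong (g≋g′ i) (bell-cong g≋g′ k (n ∸ i))))

  ⊛-bell-vanish : ∀ B g k n → n < k → (B ⊛ bell g k) n ≈ 0#
  ⊛-bell-vanish B g k n n<k =
    ⊛-vanishʳ B (bell g k) n (λ m m≤n → bell-vanish g k m (ℕ.≤-<-trans m≤n n<k))

  ⊛-bell-diagonal : ∀ B g j → (B ⊛ bell g j) j ≈ B 0 * bell g j j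
  ⊛-bell-diagonal B g j = trans
    (sumUpTo-single j 0 _ z≤n (λ i i≤j i≢0 →
      trans (ntimes-cong (j C i) (*-congˡ (bell-vanish g j (j ∸ i) (ℕ.∸-monoʳ-< (ℕ.n≢0⇒n>0 i≢0) i≤j))))
            (ntimes-zeroʳ (j C i) _)))
    (+-identityʳ _)

  bell-diagonal : ∀ g j → bell g (suc j) (suc j) ≈ g 1 * bell g j j
  bell-diagonal g j = ⊛-bell-diagonal (∂ g) g j

  compose-constant : ∀ f g → compose f g 0 ≈ f 0
  compose-constant f g = *-identityʳ _

  compose-congˡ : ∀ {f f′} g → f ≋ f′ → compose f g ≋ compose f′ g
  compose-congˡ g f≋f′ n = sumUpTo-cong n (λ k _ → *-congʳ (f≋f′ k))

  compose-congʳ : ∀ f {g g′} → g ≋⁺ g′ → compose f g ≋ compose f g′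
  compose-congʳ f g≋g′ n = sumUpTo-cong n (λ k _ → *-congˡ (bell-cong g≋g′ k n))

  compose-distrib-+ : ∀ f f′ g → compose (f +ₛ f′) g ≋ (compose f g +ₛ compose f′ g)
  compose-distrib-+ f f′ g n = trans (sumUpTo-cong n (λ k _ → distribʳ _ _ _)) (sumUpTo-+ n _ _)

  compose-index-1 : ∀ f g → compose f g 1 ≈ f 1 * g 1
  compose-index-1 f g =
    trans (+-cong (zeroʳ _) (*-congˡ (trans (+-identityʳ _) (*-identityʳ _)))) (+-identityˡ _)

  minusOne-compose : ∀ f g → minusOne (compose f g) ≋ compose (minusOne f) g
  minusOne-compose f g zero    = sym (compose-constant (minusOne f) g)
  minusOne-compose f g (suc n) = sumUpTo-cong (suc n) λ
    { zero    _ → trans (zeroʳ _) (sym (zeroˡ _))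
    ; (suc k) _ → refl }

  minusOne-cong : ∀ {a b} → a ≋ b → minusOne a ≋ minusOne b
  minusOne-cong a≋b zero    = refl
  minusOne-cong a≋b (suc n) = a≋b (suc n)

  minusOne-id : ∀ h → h 0 ≈ 0# → minusOne h ≋ h
  minusOne-id h h₀≈0 zero    = sym h₀≈0
  minusOne-id h h₀≈0 (suc n) = refl

  -- The sum may stop at n because gᵏ/k! has order k.
  ⊛-compose-sumUpTo : ∀ B r g n → sumUpTo n (λ k → (B ⊛ bell g k) n * r k) ≈ (B ⊛ compose r g) n
  ⊛-compose-sumUpTo B r g n = begin
      sumUpTo n (λ k → (B ⊛ bell g k) n * r k)
    ≈⟨ sumUpTo-cong n (λ k _ → trans (*-distribʳ-sumUpTo n (r k) _)
                                     (sumUpTo-cong n (λ i _ → ntimes-* (n C i) _ _))) ⟩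
      sumUpTo n (λ k → sumUpTo n (λ i → ntimes (n C i) ((B i * bell g k (n ∸ i)) * r k)))
    ≈⟨ sumUpTo-swap n n _ ⟩
      sumUpTo n (λ i → sumUpTo n (λ k → ntimes (n C i) ((B i * bell g k (n ∸ i)) * r k)))
    ≈⟨ sumUpTo-cong n (λ i _ → trans (sym (ntimes-distrib-sumUpTo n (n C i) _))
         (ntimes-cong (n C i) (trans (sumUpTo-cong n (λ k _ → trans (*-assoc _ _ _) (*-congˡ (*-comm _ _))))
                                     (sym (*-distribˡ-sumUpTo n (B i) _))))) ⟩
      sumUpTo n (λ i → ntimes (n C i) (B i * sumUpTo n (λ k → r k * bell g k (n ∸ i))))
    ≈⟨ sumUpTo-cong n (λ i _ → ntimes-cong (n C i) (*-congˡ
         (sumUpTo-truncate (n ∸ i) n _ (ℕ.m∸n≤m n i)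
           (λ k n∸i<k _ → trans (*-congˡ (bell-vanish g k (n ∸ i) n∸i<k)) (zeroʳ _))))) ⟩
      (B ⊛ compose r g) n ∎
    where open ≈-Reasoning

  compose-chain : ∀ f g n → compose f g (suc n) ≈ (compose (∂ f) g ⊛ ∂ g) n
  compose-chain f g n = begin
      compose f g (suc n)
    ≈⟨ sumUpTo-unfoldˡ n _ ⟩
      f 0 * 0# + sumUpTo n (λ k → f (suc k) * (∂ g ⊛ bell g k) n)
    ≈⟨ trans (+-congʳ (zeroʳ _)) (+-identityˡ _) ⟩
      sumUpTo n (λ k → f (suc k) * (∂ g ⊛ bell g k) n)
    ≈⟨ sumUpTo-cong n (λ k _ → *-comm _ _) ⟩
      sumUpTo n (λ k → (∂ g ⊛ bell g k) n * ∂ f k)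
    ≈⟨ ⊛-compose-sumUpTo (∂ g) (∂ f) g n ⟩
      (∂ g ⊛ compose (∂ f) g) n
    ≈⟨ ⊛-comm (∂ g) _ n ⟩
      (compose (∂ f) g ⊛ ∂ g) n ∎
    where open ≈-Reasoning

  compose-tpow : ∀ k g → compose (tpow k) g ≋ bell g k
  compose-tpow zero    g n = trans
    (sumUpTo-single n 0 _ z≤n λ { zero _ 0≢0 → ⊥-elim (0≢0 ≡.refl) ; (suc k) _ _ → zeroˡ _ })
    (*-identityˡ _)
  compose-tpow (suc k) g zero    = zeroˡ _
  compose-tpow (suc k) g (suc n) = begin
    compose (tpow (suc k)) g (suc n) ≈⟨ compose-chain (tpow (suc k)) g n ⟩
    (compose (tpow k) g ⊛ ∂ g) n     ≈⟨ ⊛-congʳ (∂ g) (compose-tpow k g) n ⟩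
    (bell g k ⊛ ∂ g) n               ≈⟨ ⊛-comm (bell g k) (∂ g) n ⟩
    bell g (suc k) (suc n)           ∎
    where open ≈-Reasoning

  compose-t : ∀ g → compose (tpow 1) g ≋ minusOne g
  compose-t g zero    = compose-tpow 1 g zero
  compose-t g (suc n) = trans (compose-tpow 1 g (suc n)) (⊛-identityʳ (∂ g) n)

  compose-homo-⊛ : ∀ a b g → compose (a ⊛ b) g ≋ (compose a g ⊛ compose b g)
  compose-homo-⊛ a b g = ≋[≤]⇒≋ (λ n → homo n a b)
    where
      homo : ∀ n a b → compose (a ⊛ b) g ≋[≤ n ] (compose a g ⊛ compose b g)
      homo zero a b = ≋[≤0] (begin
        compose (a ⊛ b) g 0                  ≈⟨ trans (compose-constant (a ⊛ b) g) (⊛-constant a b) ⟩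
        a 0 * b 0                            ≈⟨ *-cong (compose-constant a g) (compose-constant b g) ⟨
        compose a g 0 * compose b g 0        ≈⟨ ⊛-constant (compose a g) (compose b g) ⟨
        (compose a g ⊛ compose b g) 0        ∎)
        where open ≈-Reasoning
      homo (suc n) a b = ≋[≤suc] n (homo n a b) (begin
          compose (a ⊛ b) g (suc n)
        ≈⟨ compose-chain (a ⊛ b) g n ⟩
          (compose (∂ (a ⊛ b)) g ⊛ ∂ g) n
        ≈⟨ ⊛-cong≤ n {b = ∂ g} (λ m m≤n → trans (compose-congˡ g (⊛-leibniz a b) m)
                        (trans (compose-distrib-+ (∂ a ⊛ b) (a ⊛ ∂ b) g m)
                               (+-cong (homo n (∂ a) b m m≤n) (homo n a (∂ b) m m≤n))))
                     (≋⇒≋[≤] ≋-refl n) ⟩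
          (((∂a∘g ⊛ b∘g) +ₛ (a∘g ⊛ ∂b∘g)) ⊛ ∂ g) n
        ≈⟨ ⊛-distribʳ (∂a∘g ⊛ b∘g) (a∘g ⊛ ∂b∘g) (∂ g) n ⟩
          ((∂a∘g ⊛ b∘g) ⊛ ∂ g) n + ((a∘g ⊛ ∂b∘g) ⊛ ∂ g) n
        ≈⟨ +-cong (trans (⊛-assoc ∂a∘g b∘g (∂ g) n)
                   (trans (⊛-congˡ ∂a∘g (⊛-comm b∘g (∂ g)) n) (sym (⊛-assoc ∂a∘g (∂ g) b∘g n))))
                  (⊛-assoc a∘g ∂b∘g (∂ g) n) ⟩
          ((∂a∘g ⊛ ∂ g) ⊛ b∘g) n + (a∘g ⊛ (∂b∘g ⊛ ∂ g)) n
        ≈⟨ +-cong (⊛-congʳ b∘g (compose-chain a g) n) (⊛-congˡ a∘g (compose-chain b g) n) ⟨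
          (∂ a∘g ⊛ b∘g) n + (a∘g ⊛ ∂ b∘g) n
        ≈⟨ ⊛-leibniz a∘g b∘g n ⟨
          (a∘g ⊛ b∘g) (suc n) ∎)
        where
          open ≈-Reasoning
          a∘g b∘g ∂a∘g ∂b∘g : Seq
          a∘g  = compose a g
          b∘g  = compose b g
          ∂a∘g = compose (∂ a) g
          ∂b∘g = compose (∂ b) g

  compose-assoc : ∀ f g h → compose (compose f g) h ≋ compose f (compose g h)
  compose-assoc f g h = ≋[≤]⇒≋ (λ n → assoc n f)
    where
      g∘h : Seq
      g∘h = compose g h
      assoc : ∀ n f → compose (compose f g) h ≋[≤ n ] compose f g∘h
      assoc zero f = ≋[≤0] (trans (compose-constant (compose f g) h)
                                  (trans (compose-constant f g) (sym (compose-constant f g∘h))))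
      assoc (suc n) f = ≋[≤suc] n (assoc n f) (begin
          compose (compose f g) h (suc n)
        ≈⟨ compose-chain (compose f g) h n ⟩
          (compose (∂ (compose f g)) h ⊛ ∂ h) n
        ≈⟨ ⊛-congʳ (∂ h) (compose-congˡ h (compose-chain f g)) n ⟩
          (compose (compose (∂ f) g ⊛ ∂ g) h ⊛ ∂ h) n
        ≈⟨ ⊛-congʳ (∂ h) (compose-homo-⊛ (compose (∂ f) g) (∂ g) h) n ⟩
          ((compose (compose (∂ f) g) h ⊛ compose (∂ g) h) ⊛ ∂ h) n
        ≈⟨ ⊛-cong≤ n {b = ∂ h}
             (λ m m≤n → ⊛-cong≤ m {b = compose (∂ g) h}
                          (λ i i≤m → assoc n (∂ f) i (ℕ.≤-trans i≤m m≤n)) (≋⇒≋[≤] ≋-refl m))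
             (≋⇒≋[≤] ≋-refl n) ⟩
          ((compose (∂ f) g∘h ⊛ compose (∂ g) h) ⊛ ∂ h) n
        ≈⟨ ⊛-assoc (compose (∂ f) g∘h) (compose (∂ g) h) (∂ h) n ⟩
          (compose (∂ f) g∘h ⊛ (compose (∂ g) h ⊛ ∂ h)) n
        ≈⟨ ⊛-congˡ (compose (∂ f) g∘h) (compose-chain g h) n ⟨
          (compose (∂ f) g∘h ⊛ ∂ g∘h) n
        ≈⟨ compose-chain f g∘h n ⟨
          compose f g∘h (suc n) ∎)
        where open ≈-Reasoning

  compose-inverse-compose : ∀ {f f′ g g′} → compose f f′ ≋ tpow 1 → compose g′ g ≋ tpow 1 →
    compose (compose f g′) (compose g f′) ≋ tpow 1
  compose-inverse-compose {f} {f′} {g} {g′} f∘f′≋t g′∘g≋t = begin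
    compose (compose f g′) (compose g f′)  ≈⟨ compose-assoc f g′ (compose g f′) ⟩
    compose f (compose g′ (compose g f′))  ≈⟨ compose-congʳ f (≋⇒≋⁺ (compose-assoc g′ g f′)) ⟨
    compose f (compose (compose g′ g) f′)  ≈⟨ compose-congʳ f (≋⇒≋⁺ (compose-congˡ f′ g′∘g≋t)) ⟩
    compose f (compose (tpow 1) f′)        ≈⟨ compose-congʳ f (≋⇒≋⁺ (compose-t f′)) ⟩
    compose f (minusOne f′)                ≈⟨ compose-congʳ f (λ _ → refl) ⟩
    compose f f′                           ≈⟨ f∘f′≋t ⟩
    tpow 1                                 ∎
    where open ≋-Reasoning

  compose-cancelˡ : ∀ {g g′} h → compose g′ g ≋ tpow 1 → h 0 ≈ 0# → compose g′ (compose g h) ≋ h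
  compose-cancelˡ {g} {g′} h g′∘g≋t h₀≈0 = begin
    compose g′ (compose g h)  ≈⟨ compose-assoc g′ g h ⟨
    compose (compose g′ g) h  ≈⟨ compose-congˡ h g′∘g≋t ⟩
    compose (tpow 1) h        ≈⟨ compose-t h ⟩
    minusOne h                ≈⟨ minusOne-id h h₀≈0 ⟩
    h                         ∎
    where open ≋-Reasoning

  compose-compose : ∀ f {g h k} → compose g h ≋ k → compose (compose f g) h ≋ compose f k
  compose-compose f {g} {h} g∘h≋k = ≋-trans (compose-assoc f g h) (compose-congʳ f (≋⇒≋⁺ g∘h≋k))

  compose-bell : ∀ h g j → compose (bell h j) g ≋ bell (compose h g) j
  compose-bell h g j = begin
    compose (bell h j) g            ≈⟨ compose-congˡ g (compose-tpow j h) ⟨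
    compose (compose (tpow j) h) g  ≈⟨ compose-assoc (tpow j) h g ⟩
    compose (tpow j) (compose h g)  ≈⟨ compose-tpow j (compose h g) ⟩
    bell (compose h g) j            ∎
    where open ≋-Reasoning

  HasCompInv-resp : ∀ {a b h} → a ≋ b → HasCompInv a h → HasCompInv b h
  HasCompInv-resp {a} {b} {h} a≋b (a₁≉0 , h₀≈0 , [a-1]∘h≋t , h∘[a-1]≋t) =
      (λ b₁≈0 → a₁≉0 (trans (a≋b 1) b₁≈0))
    , h₀≈0
    , ≋-trans (compose-congˡ h (≋-sym (minusOne-cong a≋b))) [a-1]∘h≋t
    , ≋-trans (compose-congʳ h (≋⇒≋⁺ (≋-sym a≋b))) h∘[a-1]≋t

  1+t : Seq
  1+t = tpow 0 +ₛ tpow 1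

  t⊛-suc : ∀ b n → (tpow 1 ⊛ b) (suc n) ≈ ntimes (suc n) (b n)
  t⊛-suc b n = trans (⊛-leibniz (tpow 1) b n) (+-cong (⊛-identityˡ b n) (t⊛∂b n))
    where
      t⊛∂b : ∀ n → (tpow 1 ⊛ ∂ b) n ≈ ntimes n (b n)
      t⊛∂b zero    = trans (⊛-constant (tpow 1) (∂ b)) (zeroˡ _)
      t⊛∂b (suc m) = t⊛-suc (∂ b) m

  1+t⊛recipSeq : (1+t ⊛ recipSeq) ≋ tpow 0
  1+t⊛recipSeq n = trans (⊛-distribʳ (tpow 0) (tpow 1) recipSeq n)
                         (trans (+-congʳ (⊛-identityˡ recipSeq n)) (cancel n))
    where
      open ≈-Reasoning
      cancel : ∀ n → recipSeq n + (tpow 1 ⊛ recipSeq) n ≈ tpow 0 n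
      cancel zero = trans (+-cong (trans (*-identityˡ _) (+-identityʳ 1#))
                                  (trans (⊛-constant (tpow 1) recipSeq) (zeroˡ _)))
                          (+-identityʳ 1#)
      cancel (suc m) = begin
          recipSeq (suc m) + (tpow 1 ⊛ recipSeq) (suc m)
        ≈⟨ +-congˡ (t⊛-suc recipSeq m) ⟩
          (- sign m) * ntimes (suc m ℕ.* (m !)) 1# + ntimes (suc m) (sign m * ntimes (m !) 1#)
        ≈⟨ +-cong (*-congˡ (ntimes-assoc (suc m) (m !) 1#)) (sym (*-ntimes (suc m) (sign m) _)) ⟩
          (- sign m) * ntimes (suc m) (ntimes (m !) 1#) + sign m * ntimes (suc m) (ntimes (m !) 1#)
        ≈⟨ +-congʳ (sym (-‿distribˡ-* _ _)) ⟩
          - (sign m * ntimes (suc m) (ntimes (m !) 1#)) + sign m * ntimes (suc m) (ntimes (m !) 1#)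
        ≈⟨ -‿inverseˡ _ ⟩
          0# ∎

  compose-1+t : ∀ a → a 0 ≈ 1# → compose 1+t (minusOne a) ≋ a
  compose-1+t a a₀≈1 n = trans (compose-distrib-+ (tpow 0) (tpow 1) (minusOne a) n)
    (trans (+-cong (compose-tpow 0 (minusOne a) n) (compose-t (minusOne a) n)) (1+[a-1] n))
    where
      1+[a-1] : ∀ n → tpow 0 n + minusOne (minusOne a) n ≈ a n
      1+[a-1] zero    = trans (+-identityʳ 1#) (sym a₀≈1)
      1+[a-1] (suc n) = +-identityˡ _

  negU-inverseʳ : ∀ a → a 0 ≈ 1# → (a ⊛ negU a) ≋ tpow 0
  negU-inverseʳ a a₀≈1 = begin
    a ⊛ negU a
      ≈⟨ ⊛-congʳ (negU a) (compose-1+t a a₀≈1) ⟨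
    compose 1+t (minusOne a) ⊛ compose recipSeq (minusOne a)
      ≈⟨ compose-homo-⊛ 1+t recipSeq (minusOne a) ⟨
    compose (1+t ⊛ recipSeq) (minusOne a)
      ≈⟨ compose-congˡ (minusOne a) 1+t⊛recipSeq ⟩
    compose (tpow 0) (minusOne a)
      ≈⟨ compose-tpow 0 (minusOne a) ⟩
    tpow 0 ∎
    where open ≋-Reasoning

  negU-constant : ∀ a → negU a 0 ≈ 1#
  negU-constant a =
    trans (compose-constant recipSeq (minusOne a)) (trans (*-identityˡ _) (+-identityʳ 1#))

  negU-unique : ∀ a {x} → a 0 ≈ 1# → (a ⊛ x) ≋ tpow 0 → x ≋ negU a
  negU-unique a {x} a₀≈1 a⊛x≋1 = begin
    x                       ≈⟨ ⊛-identityˡ x ⟨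
    tpow 0 ⊛ x              ≈⟨ ⊛-congʳ x (≋-trans (⊛-comm (negU a) a) (negU-inverseʳ a a₀≈1)) ⟨
    (negU a ⊛ a) ⊛ x        ≈⟨ ⊛-assoc (negU a) a x ⟩
    negU a ⊛ (a ⊛ x)        ≈⟨ ⊛-congˡ (negU a) a⊛x≋1 ⟩
    negU a ⊛ tpow 0         ≈⟨ ⊛-identityʳ (negU a) ⟩
    negU a                  ∎
    where open ≋-Reasoning

  negU-compose : ∀ a h → negU (compose a h) ≋ compose (negU a) h
  negU-compose a h = begin
    compose recipSeq (minusOne (compose a h))  ≈⟨ compose-congʳ recipSeq (≋⇒≋⁺ (minusOne-compose a h)) ⟩
    compose recipSeq (compose (minusOne a) h)  ≈⟨ compose-assoc recipSeq (minusOne a) h ⟨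
    compose (compose recipSeq (minusOne a)) h  ∎
    where open ≋-Reasoning

  negU-quotient : ∀ a b → a 0 ≈ 1# → b 0 ≈ 1# → (negU (a ⊛ negU b) ⊛ negU b) ≋ negU a
  negU-quotient a b a₀≈1 b₀≈1 = negU-unique a a₀≈1 (begin
    a ⊛ (negU p ⊛ negU b)   ≈⟨ ⊛-congˡ a (⊛-comm (negU p) (negU b)) ⟩
    a ⊛ (negU b ⊛ negU p)   ≈⟨ ⊛-assoc a (negU b) (negU p) ⟨
    p ⊛ negU p              ≈⟨ negU-inverseʳ p p₀≈1 ⟩
    tpow 0                  ∎)
    where
      open ≋-Reasoning
      p : Seq
      p = a ⊛ negU b
      p₀≈1 : p 0 ≈ 1#
      p₀≈1 = trans (⊛-constant a (negU b)) (trans (*-cong a₀≈1 (negU-constant b)) (*-identityˡ 1#))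

  -- (log ∘ (eᵗ − 1))′ = eᵗ / eᵗ = 1 by the chain rule.
  log∘expm1 : compose logSeq (minusOne expSeq) ≋ tpow 1
  log∘expm1 zero    = compose-constant logSeq (minusOne expSeq)
  log∘expm1 (suc n) = begin
    compose logSeq (minusOne expSeq) (suc n) ≈⟨ compose-chain logSeq (minusOne expSeq) n ⟩
    (negU expSeq ⊛ expSeq) n                 ≈⟨ ⊛-comm (negU expSeq) expSeq n ⟩
    (expSeq ⊛ negU expSeq) n                 ≈⟨ negU-inverseʳ expSeq refl n ⟩
    tpow 1 (suc n)                           ∎
    where open ≈-Reasoning

  -- G = e^{log(1+t)} − 1 satisfies G′ = (1 + G)/(1 + t), so G ≋ t by induction on the degree.
  expm1∘log : compose (minusOne expSeq) logSeq ≋ tpow 1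
  expm1∘log = ≋[≤]⇒≋ agree
    where
      open ≈-Reasoning
      G : Seq
      G = compose (minusOne expSeq) logSeq
      exp∘log≋1+G : compose expSeq logSeq ≋ (tpow 0 +ₛ G)
      exp∘log≋1+G zero    = trans (compose-constant expSeq logSeq)
        (sym (trans (+-congˡ (compose-constant (minusOne expSeq) logSeq)) (+-identityʳ 1#)))
      exp∘log≋1+G (suc m) = trans (minusOne-compose expSeq logSeq (suc m)) (sym (+-identityˡ _))
      agree : ∀ n → G ≋[≤ n ] tpow 1
      agree zero    = ≋[≤0] (compose-constant (minusOne expSeq) logSeq)
      agree (suc n) = ≋[≤suc] n (agree n) (begin
          G (suc n)
        ≈⟨ compose-chain (minusOne expSeq) logSeq n ⟩
          (compose expSeq logSeq ⊛ recipSeq) n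
        ≈⟨ ⊛-cong≤ n {b = recipSeq} (λ m m≤n → trans (exp∘log≋1+G m) (+-congˡ (agree n m m≤n)))
                                   (≋⇒≋[≤] ≋-refl n) ⟩
          (1+t ⊛ recipSeq) n
        ≈⟨ 1+t⊛recipSeq n ⟩
          tpow 1 (suc n) ∎)

  adjoint-exp : ∀ h → adjoint h ≋ compose expSeq h
  adjoint-exp h = begin
    compose bellU (compose logSeq (minusOne (invU h)))
      ≈⟨ compose-congʳ bellU (≋⇒≋⁺ (compose-congʳ logSeq (λ _ → refl))) ⟩
    compose (compose expSeq (minusOne expSeq)) (compose logSeq h)
      ≈⟨ compose-assoc expSeq (minusOne expSeq) (compose logSeq h) ⟩
    compose expSeq (compose (minusOne expSeq) (compose logSeq h))
      ≈⟨ compose-congʳ expSeq (≋⇒≋⁺ (compose-assoc (minusOne expSeq) logSeq h)) ⟨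
    compose expSeq (compose (compose (minusOne expSeq) logSeq) h)
      ≈⟨ compose-congʳ expSeq (≋⇒≋⁺ (compose-congˡ h expm1∘log)) ⟩
    compose expSeq (compose (tpow 1) h)
      ≈⟨ compose-congʳ expSeq (≋⇒≋⁺ (compose-t h)) ⟩
    compose expSeq (minusOne h)
      ≈⟨ compose-congʳ expSeq (λ _ → refl) ⟩
    compose expSeq h ∎
    where open ≋-Reasoning

  logU-adjoint : ∀ h → logU (adjoint h) ≋ minusOne h
  logU-adjoint h = begin
    compose logSeq (minusOne (adjoint h))
      ≈⟨ compose-congʳ logSeq (≋⇒≋⁺ (minusOne-cong (adjoint-exp h))) ⟩
    compose logSeq (minusOne (compose expSeq h))
      ≈⟨ compose-congʳ logSeq (≋⇒≋⁺ (minusOne-compose expSeq h)) ⟩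
    compose logSeq (compose (minusOne expSeq) h)
      ≈⟨ compose-assoc logSeq (minusOne expSeq) h ⟨
    compose (compose logSeq (minusOne expSeq)) h
      ≈⟨ compose-congˡ h log∘expm1 ⟩
    compose (tpow 1) h
      ≈⟨ compose-t h ⟩
    minusOne h ∎
    where open ≋-Reasoning

  dot-adjoint : ∀ a h → dot a (adjoint h) ≋ compose a h
  dot-adjoint a h = compose-congʳ a (≋⇒≋⁺ (logU-adjoint h))

  -- The polynomial umbra with generating function B(t) e^{x h(t)}.
  shefferSeries : Seq → Seq → PSeq
  shefferSeries B h n k = (B ⊛ bell h k) n

  shefferSeries-cong : ∀ {B B′ h h′} → B ≋ B′ → h ≋⁺ h′ → shefferSeries B h ≋₂ shefferSeries B′ h′
  shefferSeries-cong B≋B′ h≋h′ n k = ⊛-cong B≋B′ (bell-cong h≋h′ k) n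

  sheffer-expansion : ∀ a h → sheffer a h ≋₂ shefferSeries (compose (negU a) h) h
  sheffer-expansion a h n k = begin
    compose (negU a ⊛ tpow k) (logU (adjoint h)) n
      ≈⟨ compose-congʳ (negU a ⊛ tpow k) (≋⇒≋⁺ (logU-adjoint h)) n ⟩
    compose (negU a ⊛ tpow k) h n
      ≈⟨ compose-homo-⊛ (negU a) (tpow k) h n ⟩
    (compose (negU a) h ⊛ compose (tpow k) h) n
      ≈⟨ ⊛-congˡ (compose (negU a) h) (compose-tpow k h) n ⟩
    (compose (negU a) h ⊛ bell h k) n ∎
    where open ≈-Reasoning

  umbralSubst-cong : ∀ {q q′ r r′} → q ≋₂ q′ → r ≋₂ r′ → umbralSubst q r ≋₂ umbralSubst q′ r′
  umbralSubst-cong q≋q′ r≋r′ n j = sumUpTo-cong n (λ k _ → *-cong (q≋q′ n k) (r≋r′ k j))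

  umbralSubst-shefferSeries : ∀ B N g h →
    umbralSubst (shefferSeries B g) (shefferSeries N h)
      ≋₂ shefferSeries (B ⊛ compose N g) (compose h g)
  umbralSubst-shefferSeries B N g h n j = begin
      sumUpTo n (λ k → (B ⊛ bell g k) n * (N ⊛ bell h j) k)
    ≈⟨ ⊛-compose-sumUpTo B (N ⊛ bell h j) g n ⟩
      (B ⊛ compose (N ⊛ bell h j) g) n
    ≈⟨ ⊛-congˡ B (compose-homo-⊛ N (bell h j) g) n ⟩
      (B ⊛ (compose N g ⊛ compose (bell h j) g)) n
    ≈⟨ ⊛-congˡ B (⊛-congˡ (compose N g) (compose-bell h g j)) n ⟩
      (B ⊛ (compose N g ⊛ bell (compose h g) j)) n
    ≈⟨ ⊛-assoc B (compose N g) (bell (compose h g) j) n ⟨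
      ((B ⊛ compose N g) ⊛ bell (compose h g) j) n ∎
    where open ≈-Reasoning

  sheffer-substitution-coefficient : ∀ {α δ hγ hζ hΓ} → IsScalar α → IsScalar δ → compose hζ hΓ ≋ hγ →
    (compose (negU (dot (α ⊕ negU δ) (adjoint hζ))) hΓ ⊛ compose (compose (negU δ) hζ) hΓ)
      ≋ compose (negU α) hγ
  sheffer-substitution-coefficient {α} {δ} {hγ} {hζ} {hΓ} α₀≈1 δ₀≈1 hζ∘hΓ≋hγ = begin
    compose (negU (dot p (adjoint hζ))) hΓ ⊛ N
      ≈⟨ ⊛-congʳ N (compose-congˡ hΓ (compose-congʳ recipSeq (≋⇒≋⁺ (dot-adjoint p hζ)))) ⟩
    compose (negU (compose p hζ)) hΓ ⊛ N
      ≈⟨ ⊛-congʳ N (compose-congˡ hΓ (negU-compose p hζ)) ⟩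
    compose (compose (negU p) hζ) hΓ ⊛ compose (compose (negU δ) hζ) hΓ
      ≈⟨ ⊛-cong (compose-compose (negU p) hζ∘hΓ≋hγ) (compose-compose (negU δ) hζ∘hΓ≋hγ) ⟩
    compose (negU p) hγ ⊛ compose (negU δ) hγ
      ≈⟨ compose-homo-⊛ (negU p) (negU δ) hγ ⟨
    compose (negU p ⊛ negU δ) hγ
      ≈⟨ compose-congˡ hγ (negU-quotient α δ α₀≈1 δ₀≈1) ⟩
    compose (negU α) hγ ∎
    where
      open ≋-Reasoning
      p N : Seq
      p = α ⊛ negU δ
      N = compose (compose (negU δ) hζ) hΓ

  sheffer-substitution : ∀ {α δ hγ hζ hΓ} → IsScalar α → IsScalar δ → compose hζ hΓ ≋ hγ →
    umbralSubst (sheffer (dot (α ⊕ negU δ) (adjoint hζ)) hΓ) (sheffer δ hζ) ≋₂ sheffer α hγ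
  sheffer-substitution {α} {δ} {hγ} {hζ} {hΓ} α₀≈1 δ₀≈1 hζ∘hΓ≋hγ n j = begin
      umbralSubst (sheffer A hΓ) (sheffer δ hζ) n j
    ≈⟨ umbralSubst-cong (sheffer-expansion A hΓ) (sheffer-expansion δ hζ) n j ⟩
      umbralSubst (shefferSeries B hΓ) (shefferSeries N hζ) n j
    ≈⟨ umbralSubst-shefferSeries B N hΓ hζ n j ⟩
      shefferSeries (B ⊛ compose N hΓ) (compose hζ hΓ) n j
    ≈⟨ shefferSeries-cong (sheffer-substitution-coefficient α₀≈1 δ₀≈1 hζ∘hΓ≋hγ) (≋⇒≋⁺ hζ∘hΓ≋hγ) n j ⟩
      shefferSeries (compose (negU α) hγ) hγ n j
    ≈⟨ sheffer-expansion α hγ n j ⟨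
      sheffer α hγ n j ∎
    where
      open ≈-Reasoning
      A B N : Seq
      A = dot (α ⊕ negU δ) (adjoint hζ)
      B = compose (negU A) hΓ
      N = compose (negU δ) hζ

module Triangular {c ℓ : Level} (D : IntegralDomain c ℓ) where
  open IntegralDomain D
  open CommutativeRing commRing hiding (zero)
  open Umbral commRing
  open Sums commRing
  open Series commRing
  open import Algebra.Properties.Ring ring using ([y-z]x≈yx-zx; x∙y⁻¹≈ε⇒x≈y; x≈y⇒x∙y⁻¹≈ε)

  *-nonzero : ∀ {x y} → ¬ x ≈ 0# → ¬ y ≈ 0# → ¬ x * y ≈ 0#
  *-nonzero x≉0 y≉0 xy≈0 with noZeroDivs _ _ xy≈0
  ... | inj₁ x≈0 = x≉0 x≈0
  ... | inj₂ y≈0 = y≉0 y≈0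

  IsLowerTriangular : PSeq → Set ℓ
  IsLowerTriangular p = ∀ n k → n < k → p n k ≈ 0#

  -- The entries of d are shown to vanish from index n downwards; the fuel bounds n + 1 − j.
  lowerTriangular-kernel : ∀ n (d : ℕ → Carrier) {r} → IsLowerTriangular r → (∀ j → ¬ r j j ≈ 0#) →
    (∀ k → n < k → d k ≈ 0#) → (∀ j → sumUpTo n (λ k → d k * r k j) ≈ 0#) → ∀ k → d k ≈ 0#
  lowerTriangular-kernel n d {r} r-lower r-diag d-above d·r≈0 k =
    vanish (suc n) k (ℕ.≤-trans (ℕ.n<1+n n) (ℕ.m≤n+m (suc n) k))
    where
      off-diagonal : ∀ j → (∀ k → j < k → d k ≈ 0#) → ∀ k → k ≤ n → k ≢ j → d k * r k j ≈ 0#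
      off-diagonal j above k _ k≢j with ℕ.<-cmp k j
      ... | tri< k<j _ _ = trans (*-congˡ (r-lower k j k<j)) (zeroʳ _)
      ... | tri≈ _ k≡j _ = ⊥-elim (k≢j k≡j)
      ... | tri> _ _ j<k = trans (*-congʳ (above k j<k)) (zeroˡ _)
      step : ∀ j → (∀ k → j < k → d k ≈ 0#) → d j ≈ 0#
      step j above with ℕ.≤-<-connex j n
      ... | inj₂ n<j = d-above j n<j
      ... | inj₁ j≤n
        with noZeroDivs _ _ (trans (sym (sumUpTo-single n j _ j≤n (off-diagonal j above))) (d·r≈0 j))
      ...   | inj₁ dⱼ≈0  = dⱼ≈0
      ...   | inj₂ rⱼⱼ≈0 = ⊥-elim (r-diag j rⱼⱼ≈0)
      vanish : ∀ fuel j → n < j ℕ.+ fuel → d j ≈ 0#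
      vanish zero     j n<j+0 = d-above j (≡.subst (n <_) (ℕ.+-identityʳ j) n<j+0)
      vanish (suc f) j n<j+1+f = step j (λ k j<k →
        vanish f k (ℕ.<-≤-trans (≡.subst (n <_) (ℕ.+-suc j f) n<j+1+f) (ℕ.+-monoˡ-≤ f j<k)))

  umbralSubst-cancelʳ : ∀ {p q r} → IsLowerTriangular p → IsLowerTriangular q →
    IsLowerTriangular r → (∀ j → ¬ r j j ≈ 0#) → umbralSubst p r ≋₂ umbralSubst q r → p ≋₂ q
  umbralSubst-cancelʳ {p} {q} {r} p-lower q-lower r-lower r-diag pr≋qr n k =
    x∙y⁻¹≈ε⇒x≈y _ _ (lowerTriangular-kernel n (λ k → p n k - q n k) r-lower r-diag
      (λ k n<k → trans (+-cong (p-lower n k n<k) (-‿cong (q-lower n k n<k))) (x≈y⇒x∙y⁻¹≈ε refl))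
      difference k)
    where
      open ≈-Reasoning
      difference : ∀ j → sumUpTo n (λ k → (p n k - q n k) * r k j) ≈ 0#
      difference j = begin
          sumUpTo n (λ k → (p n k - q n k) * r k j)
        ≈⟨ sumUpTo-cong n (λ k _ → [y-z]x≈yx-zx _ _ _) ⟩
          sumUpTo n (λ k → p n k * r k j - q n k * r k j)
        ≈⟨ trans (sumUpTo-+ n _ _) (+-congˡ (sumUpTo-neg n _)) ⟩
          umbralSubst p r n j - umbralSubst q r n j
        ≈⟨ x≈y⇒x∙y⁻¹≈ε (pr≋qr n j) ⟩
          0# ∎

  bell-diagonal-nonzero : ∀ g → ¬ g 1 ≈ 0# → ∀ j → ¬ bell g j j ≈ 0#
  bell-diagonal-nonzero g g₁≉0 zero    = nontrivial
  bell-diagonal-nonzero g g₁≉0 (suc j) = λ bⱼ₊₁≈0 →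
    *-nonzero g₁≉0 (bell-diagonal-nonzero g g₁≉0 j) (trans (sym (bell-diagonal g j)) bⱼ₊₁≈0)

  sheffer-lowerTriangular : ∀ a h → IsLowerTriangular (sheffer a h)
  sheffer-lowerTriangular a h n k n<k =
    trans (sheffer-expansion a h n k) (⊛-bell-vanish (compose (negU a) h) h k n n<k)

  sheffer-diagonal-nonzero : ∀ a h → ¬ h 1 ≈ 0# → ∀ j → ¬ sheffer a h j j ≈ 0#
  sheffer-diagonal-nonzero a h h₁≉0 j sⱼⱼ≈0 = *-nonzero
    (λ B₀≈0 → nontrivial (trans (sym (trans (compose-constant (negU a) h) (negU-constant a))) B₀≈0))
    (bell-diagonal-nonzero h h₁≉0 j)
    (trans (sym (trans (sheffer-expansion a h j j) (⊛-bell-diagonal B h j))) sⱼⱼ≈0)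
    where
      B : Seq
      B = compose (negU a) h

  HasCompInv⇒linear-nonzero : ∀ {γ h} → HasCompInv γ h → ¬ h 1 ≈ 0#
  HasCompInv⇒linear-nonzero {γ} {h} (_ , _ , [γ-1]∘h≋t , _) h₁≈0 = nontrivial (begin
    1#                             ≈⟨ [γ-1]∘h≋t 1 ⟨
    compose (minusOne γ) h 1       ≈⟨ compose-index-1 (minusOne γ) h ⟩
    γ 1 * h 1                      ≈⟨ *-congˡ h₁≈0 ⟩
    γ 1 * 0#                       ≈⟨ zeroʳ _ ⟩
    0#                             ∎)
    where open ≈-Reasoning

  HasCompInv-compose : ∀ {γ ζ hγ hζ} → HasCompInv γ hγ → HasCompInv ζ hζ →
    HasCompInv (compose γ hζ) (compose (minusOne ζ) hγ)
  HasCompInv-compose {γ} {ζ} {hγ} {hζ} (γ₁≉0 , _ , [γ-1]∘hγ≋t , hγ∘[γ-1]≋t)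
                     ζ-inv@(_ , _ , [ζ-1]∘hζ≋t , hζ∘[ζ-1]≋t) =
      (λ Γ₁≈0 → *-nonzero γ₁≉0 (HasCompInv⇒linear-nonzero ζ-inv)
                          (trans (sym (compose-index-1 γ hζ)) Γ₁≈0))
    , compose-constant (minusOne ζ) hγ
    , ≋-trans (compose-congˡ hΓ (minusOne-compose γ hζ))
              (compose-inverse-compose [γ-1]∘hγ≋t hζ∘[ζ-1]≋t)
    , ≋-trans (compose-congʳ hΓ (≋⇒≋⁺ (minusOne-compose γ hζ)))
              (compose-inverse-compose [ζ-1]∘hζ≋t hγ∘[γ-1]≋t)
    where
      hΓ : Seq
      hΓ = compose (minusOne ζ) hγ

theorem7p1 : ∀ {c ℓ} (D : IntegralDomain c ℓ) →
    let open Umbral (IntegralDomain.commRing D) in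
    (α δ γ ζ hγ hζ : Seq) (η : PSeq) →
    IsScalar α → IsScalar δ → IsScalar γ → IsScalar ζ →
    HasCompInv γ hγ → HasCompInv ζ hζ →
    IsPolyUmbra η →
    sheffer α hγ ≋₂ umbralSubst η (sheffer δ hζ) →
    Σ Seq (λ hΓ →
      HasCompInv (dot γ (dot bellU (invU hζ))) hΓ
        × (η ≋₂ sheffer (dot (α ⊕ negU δ) (adjoint hζ)) hΓ))
theorem7p1 D α δ γ ζ hγ hζ η α-scalar δ-scalar _ _
           γ-inv@(_ , hγ₀≈0 , _) ζ-inv@(_ , _ , _ , hζ∘[ζ-1]≋t) (_ , η-lower , _) η-expansion =
  hΓ , HasCompInv-resp (≋-sym (dot-adjoint γ hζ)) (HasCompInv-compose γ-inv ζ-inv) , η≋sheffer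
  where
    open IntegralDomain D
    open CommutativeRing commRing using (sym; trans)
    open Umbral commRing
    open Series commRing
    open Triangular D
    hΓ : Seq
    hΓ = compose (minusOne ζ) hγ
    η≋sheffer : η ≋₂ sheffer (dot (α ⊕ negU δ) (adjoint hζ)) hΓ
    η≋sheffer = umbralSubst-cancelʳ η-lower (sheffer-lowerTriangular _ hΓ) (sheffer-lowerTriangular δ hζ)
      (sheffer-diagonal-nonzero δ hζ (HasCompInv⇒linear-nonzero ζ-inv))
      (λ n j → trans (sym (η-expansion n j)) (sym (substitution n j)))
      where
        substitution : umbralSubst (sheffer (dot (α ⊕ negU δ) (adjoint hζ)) hΓ) (sheffer δ hζ) ≋₂ sheffer α hγ
        substitution = sheffer-substitution α-scalar δ-scalar (compose-cancelˡ hγ hζ∘[ζ-1]≋t hγ₀≈0)
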